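{- For any nonnegative integers $a,b$ and any positive integers $r,s$, in the shuffle algebra $(\mathfrak{h},\sqcup\!\sqcup)$, \begin{align*} x^ay^r\;\sqcup\!\sqcup\; x^by^s=\sum_{\substack{\alpha_1+\cdots+\alpha_{r+s}=a+b\\ \alpha_1,\ldots,\alpha_{r+s}\ge0}}\Bigg\{&\sum_{l=1}^r\binom{\alpha_1}{a}\binom{r+s-l-1}{r-l}\prod_{j=l+2}^{r+s}\delta_{\alpha_j,0}\\ &+\sum_{l=1}^s\binom{\alpha_1}{b}\binom{r+s-l-1}{s-l}\prod_{j=l+2}^{r+s}\delta_{\alpha_j,0}\Bigg\}x^{\alpha_1}y\cdots x^{\alpha_{r+s}}y. \end{align*}
   Context: $\mathfrak{h}=\mathbb{Q}\langle x,y\rangle$ is spanned by words in the noncommuting letters $x,y$ (including the empty word $1$); the shuffle product $\sqcup\!\sqcup$ is defined bilinearly by $1\sqcup\!\sqcup w=w\sqcup\!\sqcup1=w$ and $aw_1\sqcup\!\sqcup bw_2=a(w_1\sqcup\!\sqcup bw_2)+b(aw_1\sqcup\!\sqcup w_2)$ for letters $a,b$ and words $w,w_1,w_2$. Conventions: $\delta_{ij}$ is the Kronecker delta; $\binom{\alpha}{\beta}=0$ if $\beta<0$ or $\alpha<\beta$; empty products equal $1$. -}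

module Defs where

open import Data.Nat using (ℕ; zero; suc; _+_; _*_; _∸_)
open import Data.Nat.Combinatorics using (_C_)
open import Data.Bool using (Bool; true; false; if_then_else_)
open import Data.List using (List; []; _∷_; _++_; map; concatMap; upTo; replicate; drop)
open import Data.Nat.ListAction using (sum; product)
open import Data.Integer using (+_)
open import Data.Product using (_×_; _,_)
open import Data.Rational using (ℚ; 0ℚ; 1ℚ)
open import Relation.Binary.PropositionalEquality using (_≡_)
import Data.Rational as Q
import Data.Nat as N

data Letter : Set where
  x y : Letter

Word : Set
Word = List Letter

_≟L_ : Letter → Letter → Bool
x ≟L x = true
y ≟L y = true
_ ≟L _ = false

_≟W_ : Word → Word → Bool
[] ≟W [] = true
(a ∷ u) ≟W (b ∷ v) = if a ≟L b then u ≟W v else false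
_ ≟W _ = false

-- An element of 𝔥 = ℚ⟨x,y⟩ is represented by a finite formal sum
-- Σ cᵢ wᵢ (list of coefficient/word pairs); two representations denote
-- the same element of 𝔥 iff all their word-coefficients agree (_≈_ below).
Poly : Set
Poly = List (ℚ × Word)

coeff : Word → Poly → ℚ
coeff w [] = 0ℚ
coeff w ((c , v) ∷ p) = (if w ≟W v then c else 0ℚ) Q.+ coeff w p

infix 4 _≈_
_≈_ : Poly → Poly → Set
p ≈ q = ∀ w → coeff w p ≡ coeff w q

⟦_⟧ : Word → Poly
⟦ w ⟧ = (1ℚ , w) ∷ []

pre : Letter → Poly → Poly
pre a = map (λ { (c , w) → (c , a ∷ w) })

shw : Word → Word → Poly
shw [] v = ⟦ v ⟧
shw (a ∷ u) [] = ⟦ a ∷ u ⟧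
shw (a ∷ u) (b ∷ v) = pre a (shw u (b ∷ v)) ++ pre b (shw (a ∷ u) v)

infixl 7 _⧢_
_⧢_ : Poly → Poly → Poly
p ⧢ q = concatMap (λ { (c , u) → concatMap (λ { (d , v) →
          map (λ { (e , w) → (c Q.* d Q.* e , w) }) (shw u v) }) q }) p

xs^ : ℕ → Word
xs^ n = replicate n x

ys^ : ℕ → Word
ys^ n = replicate n y

-- weak compositions: all lists (α₁,…,α_k) of naturals with α₁+⋯+α_k = n
compositions : ℕ → ℕ → List (List ℕ)
compositions zero zero = [] ∷ []
compositions zero (suc n) = []
compositions (suc k) n =
  concatMap (λ i → map (i ∷_) (compositions k (n ∸ i))) (upTo (suc n))

wordOf : List ℕ → Word
wordOf [] = []
wordOf (α ∷ αs) = xs^ α ++ y ∷ wordOf αs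

δ : ℕ → ℕ → ℕ
δ i j = if i N.≡ᵇ j then 1 else 0

-- ∏_{j=l+2}^{k} δ_{α_j,0} for α = (α₁,…,α_k) (1-indexed): the entries after position l+1
δtail : ℕ → List ℕ → ℕ
δtail l α = product (map (λ a → δ a 0) (drop (suc l) α))

Σ1 : ℕ → (ℕ → ℕ) → ℕ
Σ1 m f = sum (map (λ i → f (suc i)) (upTo m))

-- first entry α₁ of α (α is never empty in the use below since r+s ≥ 2)
head0 : List ℕ → ℕ
head0 [] = 0
head0 (a ∷ _) = a

coefRHS : ℕ → ℕ → ℕ → ℕ → List ℕ → ℕ
coefRHS a b r s α =
    Σ1 r (λ l → ((head0 α) C a) * (((r + s) ∸ l ∸ 1) C (r ∸ l)) * δtail l α)
  + Σ1 s (λ l → ((head0 α) C b) * (((r + s) ∸ l ∸ 1) C (s ∸ l)) * δtail l α)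

rhs : ℕ → ℕ → ℕ → ℕ → Poly
rhs a b r s = map (λ α → ((+ coefRHS a b r s α) Q./ 1 , wordOf α)) (compositions (r + s) (a + b))

module Submission where

-- Both sides are compared word by word. The coefficient of w in u ⧢ v counts the interleavings
-- of u and v giving w, and the coefficient of w on the right is the weight of the composition α
-- with wordOf α = w. Both obey the same recursion in the first letter of w: an x lowers α₁
-- together with a or b, matched by Pascal's rule on C(α₁,a) and C(α₁,b); a y strips a zero part
-- and can only be taken from a factor whose x's are used up. When a = 0 and the first factor is
-- exhausted, what is left of w is x^b' y^(s+1), i.e. the composition (b',0,…,0); the remaining
-- boundary values are hockey-stick sums of the binomials C(r+s-l-1, r-l).

open import Defs
open import Data.Bool using (true; false; if_then_else_)
open import Data.Bool.Properties using (if-float; if-eta)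
import Data.Integer as ℤ
import Data.Integer.Properties as ℤ
open import Data.List using (List; []; _∷_; _++_; map; concatMap; upTo; applyUpTo; replicate; length)
open import Data.List.Properties using (map-++; map-∘; map-cong; map-upTo; map-applyUpTo; ++-identityʳ)
open import Data.Nat using (ℕ; zero; suc; _+_; _*_; _∸_; _≤_; _<_; z≤n; s≤s)
open import Data.Nat.Combinatorics using (_C_; nCk≡nC[n∸k]; k>n⇒nCk≡0; nCn≡1; nCk+nC[k+1]≡[n+1]C[k+1])
open import Data.Nat.Coprimality as Coprime using (1-coprimeTo)
open import Data.Nat.ListAction using (sum)
open import Data.Nat.ListAction.Properties using (sum-++)
open import Data.Nat.Properties
open import Algebra.Properties.CommutativeSemigroup +-commutativeSemigroup using (interchange)
open import Data.Nat.Tactic.RingSolver using (solve-∀)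
open import Data.Product using (_,_)
open import Data.Rational using (ℚ; 0ℚ; mkℚ)
import Data.Rational as ℚ
import Data.Rational.Properties as ℚ
open import Relation.Binary.PropositionalEquality

open ≡-Reasoning

module _ {A : Set} where

  sum-map-+ : (f g : A → ℕ) (xs : List A) →
              sum (map (λ a → f a + g a) xs) ≡ sum (map f xs) + sum (map g xs)
  sum-map-+ f g [] = refl
  sum-map-+ f g (a ∷ xs) =
    trans (cong (f a + g a +_) (sum-map-+ f g xs)) (interchange (f a) (g a) _ _)

  sum-map-*ˡ : ∀ c (f : A → ℕ) (xs : List A) → sum (map (λ a → c * f a) xs) ≡ c * sum (map f xs)
  sum-map-*ˡ c f [] = sym (*-zeroʳ c)
  sum-map-*ˡ c f (a ∷ xs) =
    trans (cong (c * f a +_) (sum-map-*ˡ c f xs)) (sym (*-distribˡ-+ c (f a) _))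

  sum-map-zero : (f : A → ℕ) → (∀ a → f a ≡ 0) → (xs : List A) → sum (map f xs) ≡ 0
  sum-map-zero f f≡0 [] = refl
  sum-map-zero f f≡0 (a ∷ xs) = cong₂ _+_ (f≡0 a) (sum-map-zero f f≡0 xs)

  sum-map-concatMap : ∀ {B : Set} (f : B → ℕ) (g : A → List B) (xs : List A) →
                      sum (map f (concatMap g xs)) ≡ sum (map (λ a → sum (map f (g a))) xs)
  sum-map-concatMap f g [] = refl
  sum-map-concatMap f g (a ∷ xs) = begin
    sum (map f (g a ++ concatMap g xs))               ≡⟨ cong sum (map-++ f (g a) _) ⟩
    sum (map f (g a) ++ map f (concatMap g xs))       ≡⟨ sum-++ (map f (g a)) _ ⟩
    sum (map f (g a)) + sum (map f (concatMap g xs))  ≡⟨ cong (sum (map f (g a)) +_) (sum-map-concatMap f g xs) ⟩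
    sum (map f (g a)) + sum (map (λ a → sum (map f (g a))) xs) ∎

sum-applyUpTo-cong : ∀ m {f g : ℕ → ℕ} → (∀ i → i < m → f i ≡ g i) →
                     sum (applyUpTo f m) ≡ sum (applyUpTo g m)
sum-applyUpTo-cong zero f≡g = refl
sum-applyUpTo-cong (suc m) f≡g =
  cong₂ _+_ (f≡g 0 (s≤s z≤n)) (sum-applyUpTo-cong m (λ i i<m → f≡g (suc i) (s≤s i<m)))

sum-applyUpTo-zero : ∀ m (f : ℕ → ℕ) → (∀ i → f i ≡ 0) → sum (applyUpTo f m) ≡ 0
sum-applyUpTo-zero m f f≡0 = trans (cong sum (sym (map-upTo f m))) (sum-map-zero f f≡0 (upTo m))

sum-replicate-0 : ∀ n → sum (replicate n 0) ≡ 0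
sum-replicate-0 zero = refl
sum-replicate-0 (suc n) = sum-replicate-0 n

Σ1-cong : ∀ m {f g : ℕ → ℕ} → (∀ l → f l ≡ g l) → Σ1 m f ≡ Σ1 m g
Σ1-cong m f≡g = cong sum (map-cong (λ i → f≡g (suc i)) (upTo m))

Σ1-*ˡ : ∀ m c (f : ℕ → ℕ) → Σ1 m (λ l → c * f l) ≡ c * Σ1 m f
Σ1-*ˡ m c f = sum-map-*ˡ c (λ i → f (suc i)) (upTo m)

Σ1-suc : ∀ m (f : ℕ → ℕ) → Σ1 (suc m) f ≡ f 1 + Σ1 m (λ l → f (suc l))
Σ1-suc m f = cong (f 1 +_) (cong sum
  (trans (map-applyUpTo suc (λ i → f (suc i)) m) (sym (map-upTo (λ i → f (suc (suc i))) m))))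

Σcomp : ℕ → ℕ → (List ℕ → ℕ) → ℕ
Σcomp k n F = sum (map F (compositions k n))

Σcomp-suc : ∀ k n F → Σcomp (suc k) n F ≡ sum (applyUpTo (λ i → Σcomp k (n ∸ i) (λ α → F (i ∷ α))) (suc n))
Σcomp-suc k n F = begin
  sum (map F (concatMap G (upTo (suc n))))       ≡⟨ sum-map-concatMap F G (upTo (suc n)) ⟩
  sum (map (λ i → sum (map F (G i))) (upTo (suc n)))
    ≡⟨ cong sum (map-cong (λ i → cong sum (sym (map-∘ (compositions k (n ∸ i))))) (upTo (suc n))) ⟩
  sum (map H (upTo (suc n)))                     ≡⟨ cong sum (map-upTo H (suc n)) ⟩
  sum (applyUpTo H (suc n))                      ∎
  where
  G : ℕ → List (List ℕ)
  G i = map (i ∷_) (compositions k (n ∸ i))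
  H : ℕ → ℕ
  H i = Σcomp k (n ∸ i) (λ α → F (i ∷ α))

Σcomp-cong : ∀ k n {F G : List ℕ → ℕ} → (∀ α → length α ≡ k → sum α ≡ n → F α ≡ G α) →
             Σcomp k n F ≡ Σcomp k n G
Σcomp-cong zero zero F≡G = cong (_+ 0) (F≡G [] refl refl)
Σcomp-cong zero (suc n) F≡G = refl
Σcomp-cong (suc k) n {F} {G} F≡G = begin
  Σcomp (suc k) n F  ≡⟨ Σcomp-suc k n F ⟩
  _                  ≡⟨ sum-applyUpTo-cong (suc n) (λ i i≤n → Σcomp-cong k (n ∸ i) (λ α len sum≡ →
                          F≡G (i ∷ α) (cong suc len) (trans (cong (i +_) sum≡) (m+[n∸m]≡n (≤-pred i≤n))))) ⟩
  _                  ≡⟨ Σcomp-suc k n G ⟨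
  Σcomp (suc k) n G  ∎

compCoeff : ℕ → ℕ → (List ℕ → ℕ) → Word → ℕ
compCoeff k n g w = Σcomp k n (λ α → if w ≟W wordOf α then g α else 0)

sucHead : List ℕ → List ℕ
sucHead [] = []
sucHead (h ∷ t) = suc h ∷ t

compCoeff-x∷ : ∀ k n g w → compCoeff (suc k) (suc n) g (x ∷ w) ≡ compCoeff (suc k) n (λ α → g (sucHead α)) w
compCoeff-x∷ k n g w =
  -- the compositions with α₁ = 0 drop out, since their words begin with y
  trans (Σcomp-suc k (suc n) _)
        (trans (cong (_+ later) (sum-map-zero _ (λ _ → refl) (compositions k (suc n))))
               (sym (Σcomp-suc k n _)))
  where
  later : ℕ
  later = sum (applyUpTo (λ i → Σcomp k (n ∸ i) (λ α →
            if w ≟W wordOf (i ∷ α) then g (suc i ∷ α) else 0)) (suc n))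

compCoeff-x∷-0 : ∀ k g w → compCoeff (suc k) 0 g (x ∷ w) ≡ 0
compCoeff-x∷-0 k g w =
  trans (Σcomp-suc k 0 _) (cong (_+ 0) (sum-map-zero _ (λ _ → refl) (compositions k 0)))

compCoeff-y∷ : ∀ k n g w → compCoeff (suc k) n g (y ∷ w) ≡ compCoeff k n (λ α → g (0 ∷ α)) w
compCoeff-y∷ k n g w = trans (Σcomp-suc k n _) (trans
  (cong (compCoeff k n (λ α → g (0 ∷ α)) w +_)
        (sum-applyUpTo-zero n _ (λ i → sum-map-zero _ (λ _ → refl) (compositions k (n ∸ suc i)))))
  (+-identityʳ _))

compCoeff-[] : ∀ k n g → compCoeff (suc k) n g [] ≡ 0
compCoeff-[] k n g = trans (Σcomp-suc k n _) (sum-applyUpTo-zero (suc n) _ λ i →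
  sum-map-zero _ (λ α → cong (if_then g (i ∷ α) else 0) ([]≢wordOf∷ i α)) (compositions k (n ∸ i)))
  where
  []≢wordOf∷ : ∀ i α → ([] ≟W wordOf (i ∷ α)) ≡ false
  []≢wordOf∷ zero α = refl
  []≢wordOf∷ (suc i) α = refl

compCoeff-cong : ∀ k n {g h} w → (∀ α → length α ≡ k → sum α ≡ n → g α ≡ h α) →
                 compCoeff k n g w ≡ compCoeff k n h w
compCoeff-cong k n w g≡h =
  Σcomp-cong k n (λ α len sum≡ → cong (if w ≟W wordOf α then_else 0) (g≡h α len sum≡))

compCoeff-zero : ∀ k n {g} w → (∀ α → length α ≡ k → sum α ≡ n → g α ≡ 0) → compCoeff k n g w ≡ 0
compCoeff-zero k n w g≡0 =
  trans (compCoeff-cong k n w g≡0) (sum-map-zero _ (λ α → if-eta (w ≟W wordOf α)) (compositions k n))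

compCoeff-+ : ∀ k n g h w → compCoeff k n (λ α → g α + h α) w ≡ compCoeff k n g w + compCoeff k n h w
compCoeff-+ k n g h w = trans
  (cong sum (map-cong (λ α → if-+ (w ≟W wordOf α)) (compositions k n)))
  (sum-map-+ _ _ (compositions k n))
  where
  if-+ : ∀ b {m n} → (if b then m + n else 0) ≡ (if b then m else 0) + (if b then n else 0)
  if-+ true = refl
  if-+ false = refl

compCoeff-sum≡0 : ∀ k g w → compCoeff k 0 g w ≡ (if w ≟W ys^ k then g (replicate k 0) else 0)
compCoeff-sum≡0 zero g w = +-identityʳ _
compCoeff-sum≡0 (suc k) g [] = compCoeff-[] k 0 g
compCoeff-sum≡0 (suc k) g (x ∷ w) = compCoeff-x∷-0 k g w
compCoeff-sum≡0 (suc k) g (y ∷ w) = trans (compCoeff-y∷ k 0 g w) (compCoeff-sum≡0 k (λ α → g (0 ∷ α)) w)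

shuffleCount : Word → Word → Word → ℕ
shuffleCount [] v w = if w ≟W v then 1 else 0
shuffleCount (a ∷ u) [] w = if w ≟W (a ∷ u) then 1 else 0
shuffleCount (a ∷ u) (b ∷ v) [] = 0
shuffleCount (a ∷ u) (b ∷ v) (c ∷ w) =
  (if c ≟L a then shuffleCount u (b ∷ v) w else 0) + (if c ≟L b then shuffleCount (a ∷ u) v w else 0)

shuffleCount-comm : ∀ u v w → shuffleCount u v w ≡ shuffleCount v u w
shuffleCount-comm [] [] w = refl
shuffleCount-comm [] (b ∷ v) w = refl
shuffleCount-comm (a ∷ u) [] w = refl
shuffleCount-comm (a ∷ u) (b ∷ v) [] = refl
shuffleCount-comm (a ∷ u) (b ∷ v) (c ∷ w) =
  trans (+-comm (if c ≟L a then shuffleCount u (b ∷ v) w else 0) _)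
  (cong₂ _+_ (cong (if c ≟L b then_else 0) (shuffleCount-comm (a ∷ u) v w))
             (cong (if c ≟L a then_else 0) (shuffleCount-comm u (b ∷ v) w)))

shuffleCount-ys^ : ∀ r s w → shuffleCount (ys^ r) (ys^ s) w ≡ (if w ≟W ys^ (r + s) then (r + s) C r else 0)
shuffleCount-ys^ zero s w = refl
shuffleCount-ys^ (suc r) zero w rewrite +-identityʳ r | nCn≡1 (suc r) = refl
shuffleCount-ys^ (suc r) (suc s) [] = refl
shuffleCount-ys^ (suc r) (suc s) (x ∷ w) = refl
shuffleCount-ys^ (suc r) (suc s) (y ∷ w)
  rewrite shuffleCount-ys^ r (suc s) w | shuffleCount-ys^ (suc r) s w | +-suc r s
  = pascal (w ≟W (y ∷ ys^ (r + s)))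
  where
  pascal : ∀ b → (if b then suc (r + s) C r else 0) + (if b then suc (r + s) C suc r else 0)
               ≡ (if b then suc (suc (r + s)) C suc r else 0)
  pascal true = nCk+nC[k+1]≡[n+1]C[k+1] (suc (r + s)) r
  pascal false = refl

ι : ℕ → ℚ
ι n = (ℤ.+ n) ℚ./ 1

ι-+ : ∀ m n → ι (m + n) ≡ ι m ℚ.+ ι n
ι-+ m n = sym (trans (cong₂ ℚ._+_ (ι≡mkℚ m) (ι≡mkℚ n)) (cong (ℚ._/ 1) numerator))
  where
  ι≡mkℚ : ∀ n → ι n ≡ mkℚ (ℤ.+ n) 0 (Coprime.sym (1-coprimeTo n))
  ι≡mkℚ n = ℚ.normalize-coprime (Coprime.sym (1-coprimeTo n))
  numerator : (ℤ.+ m) ℤ.* (ℤ.+ 1) ℤ.+ (ℤ.+ n) ℤ.* (ℤ.+ 1) ≡ ℤ.+ (m + n)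
  numerator rewrite ℤ.*-identityʳ (ℤ.+ m) | ℤ.*-identityʳ (ℤ.+ n) = refl

coeff-++ : ∀ w p q → coeff w (p ++ q) ≡ coeff w p ℚ.+ coeff w q
coeff-++ w [] q = sym (ℚ.+-identityˡ _)
coeff-++ w ((c , v) ∷ p) q =
  trans (cong ((if w ≟W v then c else 0ℚ) ℚ.+_) (coeff-++ w p q))
        (sym (ℚ.+-assoc (if w ≟W v then c else 0ℚ) (coeff w p) (coeff w q)))

coeff-[]-pre : ∀ a p → coeff [] (pre a p) ≡ 0ℚ
coeff-[]-pre a [] = refl
coeff-[]-pre a ((c , v) ∷ p) = cong (0ℚ ℚ.+_) (coeff-[]-pre a p)

coeff-∷-pre : ∀ c a w p → coeff (c ∷ w) (pre a p) ≡ (if c ≟L a then coeff w p else 0ℚ)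
coeff-∷-pre c a w [] = sym (if-eta (c ≟L a))
coeff-∷-pre c a w ((e , v) ∷ p) rewrite coeff-∷-pre c a w p with c ≟L a
... | true = refl
... | false = refl

coeff-shw : ∀ u v w → coeff w (shw u v) ≡ ι (shuffleCount u v w)
coeff-shw [] v w with w ≟W v
... | true = refl
... | false = refl
coeff-shw (a ∷ u) [] w with w ≟W (a ∷ u)
... | true = refl
... | false = refl
coeff-shw (a ∷ u) (b ∷ v) [] rewrite coeff-++ [] (pre a (shw u (b ∷ v))) (pre b (shw (a ∷ u) v))
  | coeff-[]-pre a (shw u (b ∷ v)) | coeff-[]-pre b (shw (a ∷ u) v) = refl
coeff-shw (a ∷ u) (b ∷ v) (c ∷ w) = begin
  coeff (c ∷ w) (pre a (shw u (b ∷ v)) ++ pre b (shw (a ∷ u) v))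
    ≡⟨ coeff-++ (c ∷ w) (pre a (shw u (b ∷ v))) _ ⟩
  coeff (c ∷ w) (pre a (shw u (b ∷ v))) ℚ.+ coeff (c ∷ w) (pre b (shw (a ∷ u) v))
    ≡⟨ cong₂ ℚ._+_ (coeff-∷-pre c a w (shw u (b ∷ v))) (coeff-∷-pre c b w (shw (a ∷ u) v)) ⟩
  (if c ≟L a then coeff w (shw u (b ∷ v)) else 0ℚ) ℚ.+ (if c ≟L b then coeff w (shw (a ∷ u) v) else 0ℚ)
    ≡⟨ cong₂ ℚ._+_ (cong (if c ≟L a then_else 0ℚ) (coeff-shw u (b ∷ v) w))
                   (cong (if c ≟L b then_else 0ℚ) (coeff-shw (a ∷ u) v w)) ⟩
  (if c ≟L a then ι (shuffleCount u (b ∷ v) w) else ι 0) ℚ.+ (if c ≟L b then ι (shuffleCount (a ∷ u) v w) else ι 0)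
    ≡⟨ cong₂ ℚ._+_ (if-float ι (c ≟L a)) (if-float ι (c ≟L b)) ⟨
  ι (if c ≟L a then shuffleCount u (b ∷ v) w else 0) ℚ.+ ι (if c ≟L b then shuffleCount (a ∷ u) v w else 0)
    ≡⟨ ι-+ (if c ≟L a then shuffleCount u (b ∷ v) w else 0) (if c ≟L b then shuffleCount (a ∷ u) v w else 0) ⟨
  ι (shuffleCount (a ∷ u) (b ∷ v) (c ∷ w)) ∎

coeff-⟦⟧⧢⟦⟧ : ∀ u v w → coeff w (⟦ u ⟧ ⧢ ⟦ v ⟧) ≡ ι (shuffleCount u v w)
coeff-⟦⟧⧢⟦⟧ u v w = trans (cong (coeff w) ⧢-words) (coeff-shw u v w)
  where
  scale-by-1 : ∀ p → map (λ { (e , w) → (ℚ.1ℚ ℚ.* ℚ.1ℚ ℚ.* e , w) }) p ≡ p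
  scale-by-1 [] = refl
  scale-by-1 ((e , w) ∷ p) = cong₂ _∷_ (cong (_, w) (ℚ.*-identityˡ e)) (scale-by-1 p)
  ⧢-words : ⟦ u ⟧ ⧢ ⟦ v ⟧ ≡ shw u v
  ⧢-words = trans (++-identityʳ _) (trans (++-identityʳ _) (scale-by-1 (shw u v)))

coeff-weighted : ∀ w (g : List ℕ → ℕ) αs →
  coeff w (map (λ α → (ι (g α) , wordOf α)) αs) ≡ ι (sum (map (λ α → if w ≟W wordOf α then g α else 0) αs))
coeff-weighted w g [] = refl
coeff-weighted w g (α ∷ αs) = begin
  (if w ≟W wordOf α then ι (g α) else ι 0) ℚ.+ coeff w (map (λ α → (ι (g α) , wordOf α)) αs)
    ≡⟨ cong₂ ℚ._+_ (sym (if-float ι (w ≟W wordOf α))) (coeff-weighted w g αs) ⟩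
  ι (if w ≟W wordOf α then g α else 0) ℚ.+ ι (sum (map (λ α → if w ≟W wordOf α then g α else 0) αs))
    ≡⟨ ι-+ (if w ≟W wordOf α then g α else 0) (sum (map (λ α → if w ≟W wordOf α then g α else 0) αs)) ⟨
  ι (sum (map (λ α → if w ≟W wordOf α then g α else 0) (α ∷ αs))) ∎

δtail-sum≡0 : ∀ l h α → sum α ≡ 0 → δtail l (h ∷ α) ≡ 1
δtail-sum≡0 zero h [] _ = refl
δtail-sum≡0 (suc l) h [] _ = refl
δtail-sum≡0 zero h (zero ∷ α) sum≡0 = cong (1 *_) (δtail-sum≡0 zero zero α sum≡0)
δtail-sum≡0 (suc l) h (a ∷ α) sum≡0 = δtail-sum≡0 l a α (m+n≡0⇒n≡0 a sum≡0)

δtail-sum≢0 : ∀ h α {m} → sum α ≡ suc m → δtail 0 (h ∷ α) ≡ 0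
δtail-sum≢0 h (zero ∷ α) sum≡ = cong (1 *_) (δtail-sum≢0 zero α sum≡)
δtail-sum≢0 h (suc a ∷ α) sum≡ = refl

[1+n]C[1+k]≡nCk : ∀ {n k} → n ≤ k → suc n C suc k ≡ n C k
[1+n]C[1+k]≡nCk {n} {k} n≤k = begin
  suc n C suc k        ≡⟨ nCk+nC[k+1]≡[n+1]C[k+1] n k ⟨
  n C k + n C suc k    ≡⟨ cong (n C k +_) (k>n⇒nCk≡0 (s≤s n≤k)) ⟩
  n C k + 0            ≡⟨ +-identityʳ (n C k) ⟩
  n C k                ∎

[s+1+r]Cs≡[r+1+s]C[1+r] : ∀ r s → (s + suc r) C s ≡ (r + suc s) C suc r
[s+1+r]Cs≡[r+1+s]C[1+r] r s = begin
  (s + suc r) C s                ≡⟨ nCk≡nC[n∸k] (m≤m+n s (suc r)) ⟩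
  (s + suc r) C (s + suc r ∸ s)  ≡⟨ cong ((s + suc r) C_) (m+n∸m≡n s (suc r)) ⟩
  (s + suc r) C suc r            ≡⟨ cong (_C suc r) (trans (+-comm s (suc r)) (sym (+-suc r s))) ⟩
  (r + suc s) C suc r            ∎

hockey-stick : ∀ m k → Σ1 (suc m) (λ l → ((suc m + k) ∸ l ∸ 1) C (suc m ∸ l)) ≡ (m + k) C m
hockey-stick zero k = refl
hockey-stick (suc m) k = begin
  Σ1 (suc (suc m)) (λ l → ((suc (suc m) + k) ∸ l ∸ 1) C (suc (suc m) ∸ l))
    ≡⟨ Σ1-suc (suc m) (λ l → ((suc (suc m) + k) ∸ l ∸ 1) C (suc (suc m) ∸ l)) ⟩
  (m + k) C suc m + Σ1 (suc m) (λ l → ((suc m + k) ∸ l ∸ 1) C (suc m ∸ l))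
    ≡⟨ cong ((m + k) C suc m +_) (hockey-stick m k) ⟩
  (m + k) C suc m + (m + k) C m  ≡⟨ +-comm ((m + k) C suc m) _ ⟩
  (m + k) C m + (m + k) C suc m  ≡⟨ nCk+nC[k+1]≡[n+1]C[k+1] (m + k) m ⟩
  suc (m + k) C suc m ∎

tailSum : ℕ → ℕ → List ℕ → ℕ
tailSum n m α = Σ1 m (λ l → ((n ∸ l ∸ 1) C (m ∸ l)) * δtail l α)

tailSum-cons : ∀ n m h α → tailSum (suc n) (suc m) (h ∷ α) ≡ ((n ∸ 1) C m) * δtail 0 α + tailSum n m α
tailSum-cons n m h α = Σ1-suc m (λ l → ((suc n ∸ l ∸ 1) C (suc m ∸ l)) * δtail l (h ∷ α))

tailSum-sum≡0 : ∀ m k {n} h α → n ≡ suc m + k → sum α ≡ 0 → tailSum n (suc m) (h ∷ α) ≡ (m + k) C m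
tailSum-sum≡0 m k h α refl sum≡0 = trans
  (Σ1-cong (suc m) {g = binomial} (λ l →
    trans (cong (binomial l *_) (δtail-sum≡0 l h α sum≡0)) (*-identityʳ (binomial l))))
  (hockey-stick m k)
  where
  binomial : ℕ → ℕ
  binomial l = ((suc m + k) ∸ l ∸ 1) C (suc m ∸ l)

coefRHS-split : ∀ a b r s α →
  coefRHS a b r s α ≡ (head0 α C a) * tailSum (r + s) r α + (head0 α C b) * tailSum (r + s) s α
coefRHS-split a b r s α = cong₂ _+_ (factor a r) (factor b s)
  where
  factor : ∀ c m → Σ1 m (λ l → (head0 α C c) * (((r + s) ∸ l ∸ 1) C (m ∸ l)) * δtail l α)
                 ≡ (head0 α C c) * tailSum (r + s) m α
  factor c m = trans (Σ1-cong m (λ l → *-assoc (head0 α C c) (((r + s) ∸ l ∸ 1) C (m ∸ l)) (δtail l α)))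
                     (Σ1-*ˡ m (head0 α C c) (λ l → (((r + s) ∸ l ∸ 1) C (m ∸ l)) * δtail l α))

coefRHS-swap : ∀ a b r s α → coefRHS a b r s α ≡ coefRHS b a s r α
coefRHS-swap a b r s α rewrite +-comm r s = +-comm
  (Σ1 r (λ l → (head0 α C a) * (((s + r) ∸ l ∸ 1) C (r ∸ l)) * δtail l α))
  (Σ1 s (λ l → (head0 α C b) * (((s + r) ∸ l ∸ 1) C (s ∸ l)) * δtail l α))

coefRHS-pascal : ∀ a b r s h t →
  coefRHS (suc a) (suc b) r s (suc h ∷ t) ≡ coefRHS a (suc b) r s (h ∷ t) + coefRHS (suc a) b r s (h ∷ t)
coefRHS-pascal a b r s h t = begin
  coefRHS (suc a) (suc b) r s (suc h ∷ t)
    ≡⟨ coefRHS-split (suc a) (suc b) r s (suc h ∷ t) ⟩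
  (suc h C suc a) * T₁ + (suc h C suc b) * T₂
    ≡⟨ cong₂ (λ p q → p * T₁ + q * T₂) (pascal h a) (pascal h b) ⟨
  (h C a + h C suc a) * T₁ + (h C b + h C suc b) * T₂
    ≡⟨ rearrange (h C a) (h C suc a) (h C b) (h C suc b) T₁ T₂ ⟩
  ((h C a) * T₁ + (h C suc b) * T₂) + ((h C suc a) * T₁ + (h C b) * T₂)
    ≡⟨ cong₂ _+_ (coefRHS-split a (suc b) r s (h ∷ t)) (coefRHS-split (suc a) b r s (h ∷ t)) ⟨
  coefRHS a (suc b) r s (h ∷ t) + coefRHS (suc a) b r s (h ∷ t) ∎
  where
  T₁ = tailSum (r + s) r (h ∷ t)
  T₂ = tailSum (r + s) s (h ∷ t)
  pascal = nCk+nC[k+1]≡[n+1]C[k+1]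
  rearrange : ∀ p q u v t₁ t₂ → (p + q) * t₁ + (u + v) * t₂ ≡ (p * t₁ + v * t₂) + (q * t₁ + u * t₂)
  rearrange = solve-∀

coefRHS-suc-suc-0∷ : ∀ a b r s α → coefRHS (suc a) (suc b) r s (0 ∷ α) ≡ 0
coefRHS-suc-suc-0∷ a b r s α = coefRHS-split (suc a) (suc b) r s (0 ∷ α)

coefRHS-0-sucHead : ∀ b r s h t → h + sum t ≡ b → coefRHS 0 (suc b) r s (suc h ∷ t) ≡ coefRHS 0 b r s (h ∷ t)
coefRHS-0-sucHead b r s h t sum≡b = begin
  coefRHS 0 (suc b) r s (suc h ∷ t)        ≡⟨ coefRHS-split 0 (suc b) r s (suc h ∷ t) ⟩
  (h C 0) * T₁ + (suc h C suc b) * T₂      ≡⟨ cong (λ c → (h C 0) * T₁ + c * T₂) ([1+n]C[1+k]≡nCk h≤b) ⟩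
  (h C 0) * T₁ + (h C b) * T₂              ≡⟨ coefRHS-split 0 b r s (h ∷ t) ⟨
  coefRHS 0 b r s (h ∷ t)                  ∎
  where
  T₁ = tailSum (r + s) r (h ∷ t)
  T₂ = tailSum (r + s) s (h ∷ t)
  h≤b : h ≤ b
  h≤b = subst (h ≤_) sum≡b (m≤m+n h (sum t))

coefRHS-0-1-0∷ : ∀ b s α → coefRHS 0 (suc b) 1 (suc s) (0 ∷ α) ≡ δtail 0 α
coefRHS-0-1-0∷ b s α = trans (coefRHS-split 0 (suc b) 1 (suc s) (0 ∷ α)) (simplify (δtail 0 α))
  where
  simplify : ∀ p → 1 * (1 * p + 0) + 0 ≡ p
  simplify = solve-∀

-- Both sides vanish unless α = (b+1, 0, …, 0).
tailSum-first-entry : ∀ b r s h t → h + sum t ≡ suc b →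
  ((r + suc s) C suc r) * δtail 0 (h ∷ t) ≡ (h C suc b) * tailSum (suc r + suc s) (suc s) (h ∷ t)
tailSum-first-entry b r s h t sum≡ with sum t in sum-t
... | zero = begin
  ((r + suc s) C suc r) * δtail 0 (h ∷ t)  ≡⟨ cong (((r + suc s) C suc r) *_) (δtail-sum≡0 0 h t sum-t) ⟩
  ((r + suc s) C suc r) * 1                ≡⟨ *-identityʳ ((r + suc s) C suc r) ⟩
  (r + suc s) C suc r                      ≡⟨ [s+1+r]Cs≡[r+1+s]C[1+r] r s ⟨
  (s + suc r) C s                          ≡⟨ tailSum-sum≡0 s (suc r) h t (+-comm (suc r) (suc s)) sum-t ⟨
  T₂                                       ≡⟨ *-identityˡ T₂ ⟨
  1 * T₂                                   ≡⟨ cong (_* T₂) (nCn≡1 (suc b)) ⟨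
  (suc b C suc b) * T₂                     ≡⟨ cong (λ n → (n C suc b) * T₂) (trans (sym (+-identityʳ h)) sum≡) ⟨
  (h C suc b) * T₂                         ∎
  where T₂ = tailSum (suc r + suc s) (suc s) (h ∷ t)
... | suc m = begin
  ((r + suc s) C suc r) * δtail 0 (h ∷ t)  ≡⟨ cong (((r + suc s) C suc r) *_) (δtail-sum≢0 h t sum-t) ⟩
  ((r + suc s) C suc r) * 0                ≡⟨ *-zeroʳ ((r + suc s) C suc r) ⟩
  0                                        ≡⟨ cong (_* T₂) (k>n⇒nCk≡0 h<1+b) ⟨
  (h C suc b) * T₂                         ∎
  where
  T₂ = tailSum (suc r + suc s) (suc s) (h ∷ t)
  h<1+b : h < suc b
  h<1+b = subst (h <_) sum≡ (m<m+n h (s≤s z≤n))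

coefRHS-0-0∷ : ∀ b r s h t → h + sum t ≡ suc b →
  coefRHS 0 (suc b) (suc (suc r)) (suc s) (0 ∷ h ∷ t) ≡ coefRHS 0 (suc b) (suc r) (suc s) (h ∷ t)
coefRHS-0-0∷ b r s h t sum≡ = begin
  coefRHS 0 (suc b) (suc (suc r)) (suc s) (0 ∷ h ∷ t)
    ≡⟨ coefRHS-split 0 (suc b) (suc (suc r)) (suc s) (0 ∷ h ∷ t) ⟩
  1 * tailSum (suc (suc r + suc s)) (suc (suc r)) (0 ∷ h ∷ t) + 0
    ≡⟨ cong (λ z → 1 * z + 0) (tailSum-cons (suc r + suc s) (suc r) 0 (h ∷ t)) ⟩
  1 * (((r + suc s) C suc r) * δtail 0 (h ∷ t) + T₁) + 0
    ≡⟨ cong (λ z → 1 * (z + T₁) + 0) (tailSum-first-entry b r s h t sum≡) ⟩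
  1 * ((h C suc b) * T₂ + T₁) + 0
    ≡⟨ simplify ((h C suc b) * T₂) T₁ ⟩
  1 * T₁ + (h C suc b) * T₂
    ≡⟨ coefRHS-split 0 (suc b) (suc r) (suc s) (h ∷ t) ⟨
  coefRHS 0 (suc b) (suc r) (suc s) (h ∷ t) ∎
  where
  T₁ = tailSum (suc r + suc s) (suc r) (h ∷ t)
  T₂ = tailSum (suc r + suc s) (suc s) (h ∷ t)
  simplify : ∀ p q → 1 * (p + q) + 0 ≡ 1 * q + p
  simplify = solve-∀

coefRHS-zeros : ∀ r s → coefRHS 0 0 (suc r) (suc s) (replicate (suc r + suc s) 0) ≡ (suc r + suc s) C suc r
coefRHS-zeros r s = begin
  coefRHS 0 0 (suc r) (suc s) (0 ∷ zeros)  ≡⟨ coefRHS-split 0 0 (suc r) (suc s) (0 ∷ zeros) ⟩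
  1 * T₁ + 1 * T₂                          ≡⟨ cong₂ _+_ (*-identityˡ T₁) (*-identityˡ T₂) ⟩
  T₁ + T₂                                  ≡⟨ cong₂ _+_ (tailSum-sum≡0 r (suc s) 0 zeros refl sum-zeros)
                                                        (tailSum-sum≡0 s (suc r) 0 zeros (+-comm (suc r) (suc s)) sum-zeros) ⟩
  (r + suc s) C r + (s + suc r) C s        ≡⟨ cong ((r + suc s) C r +_) ([s+1+r]Cs≡[r+1+s]C[1+r] r s) ⟩
  (r + suc s) C r + (r + suc s) C suc r    ≡⟨ nCk+nC[k+1]≡[n+1]C[k+1] (r + suc s) r ⟩
  (suc r + suc s) C suc r                  ∎
  where
  zeros = replicate (r + suc s) 0
  sum-zeros = sum-replicate-0 (r + suc s)
  T₁ = tailSum (suc r + suc s) (suc r) (0 ∷ zeros)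
  T₂ = tailSum (suc r + suc s) (suc s) (0 ∷ zeros)

compCoeff-δtail0 : ∀ b s w → compCoeff (suc s) b (δtail 0) w ≡ (if w ≟W (xs^ b ++ ys^ (suc s)) then 1 else 0)
compCoeff-δtail0 zero s w = trans (compCoeff-sum≡0 (suc s) (δtail 0) w)
  (cong (if w ≟W ys^ (suc s) then_else 0) (δtail-sum≡0 0 0 (replicate s 0) (sum-replicate-0 s)))
compCoeff-δtail0 (suc b) s [] = compCoeff-[] s (suc b) (δtail 0)
compCoeff-δtail0 (suc b) s (x ∷ w) = begin
  compCoeff (suc s) (suc b) (δtail 0) (x ∷ w)           ≡⟨ compCoeff-x∷ s b (δtail 0) w ⟩
  compCoeff (suc s) b (λ α → δtail 0 (sucHead α)) w     ≡⟨ compCoeff-cong (suc s) b w (λ α _ _ → δtail-sucHead α) ⟩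
  compCoeff (suc s) b (δtail 0) w                       ≡⟨ compCoeff-δtail0 b s w ⟩
  (if w ≟W (xs^ b ++ ys^ (suc s)) then 1 else 0)        ∎
  where
  δtail-sucHead : ∀ α → δtail 0 (sucHead α) ≡ δtail 0 α
  δtail-sucHead [] = refl
  δtail-sucHead (h ∷ t) = refl
compCoeff-δtail0 (suc b) s (y ∷ w) = trans (compCoeff-y∷ s (suc b) (δtail 0) w)
  (compCoeff-zero s (suc b) w (λ α _ sum≡ → δtail-sum≢0 0 α sum≡))

shuffleCount-ys^-xs^ys^ : ∀ b r s w → shuffleCount (ys^ (suc r)) (xs^ b ++ ys^ (suc s)) w
                                      ≡ compCoeff (suc r + suc s) b (coefRHS 0 b (suc r) (suc s)) w
shuffleCount-ys^-xs^ys^ zero r s w = begin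
  shuffleCount (ys^ (suc r)) (ys^ (suc s)) w
    ≡⟨ shuffleCount-ys^ (suc r) (suc s) w ⟩
  (if w ≟W ys^ (suc r + suc s) then (suc r + suc s) C suc r else 0)
    ≡⟨ cong (if w ≟W ys^ (suc r + suc s) then_else 0) (coefRHS-zeros r s) ⟨
  (if w ≟W ys^ (suc r + suc s) then coefRHS 0 0 (suc r) (suc s) (replicate (suc r + suc s) 0) else 0)
    ≡⟨ compCoeff-sum≡0 (suc r + suc s) (coefRHS 0 0 (suc r) (suc s)) w ⟨
  compCoeff (suc r + suc s) 0 (coefRHS 0 0 (suc r) (suc s)) w ∎
shuffleCount-ys^-xs^ys^ (suc b) r s [] = sym (compCoeff-[] (r + suc s) (suc b) _)
shuffleCount-ys^-xs^ys^ (suc b) r s (x ∷ w) = begin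
  shuffleCount (ys^ (suc r)) (xs^ b ++ ys^ (suc s)) w
    ≡⟨ shuffleCount-ys^-xs^ys^ b r s w ⟩
  compCoeff (suc r + suc s) b (coefRHS 0 b (suc r) (suc s)) w
    ≡⟨ compCoeff-cong (suc r + suc s) b w shift ⟨
  compCoeff (suc r + suc s) b (λ α → coefRHS 0 (suc b) (suc r) (suc s) (sucHead α)) w
    ≡⟨ compCoeff-x∷ (r + suc s) b (coefRHS 0 (suc b) (suc r) (suc s)) w ⟨
  compCoeff (suc r + suc s) (suc b) (coefRHS 0 (suc b) (suc r) (suc s)) (x ∷ w) ∎
  where
  shift : ∀ α → length α ≡ suc r + suc s → sum α ≡ b →
          coefRHS 0 (suc b) (suc r) (suc s) (sucHead α) ≡ coefRHS 0 b (suc r) (suc s) α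
  shift (h ∷ t) _ sum≡b = coefRHS-0-sucHead b (suc r) (suc s) h t sum≡b
shuffleCount-ys^-xs^ys^ (suc b) zero s (y ∷ w) = begin
  (if w ≟W (xs^ (suc b) ++ ys^ (suc s)) then 1 else 0) + 0
    ≡⟨ +-identityʳ _ ⟩
  (if w ≟W (xs^ (suc b) ++ ys^ (suc s)) then 1 else 0)
    ≡⟨ compCoeff-δtail0 (suc b) s w ⟨
  compCoeff (suc s) (suc b) (δtail 0) w
    ≡⟨ compCoeff-cong (suc s) (suc b) w (λ α _ _ → coefRHS-0-1-0∷ b s α) ⟨
  compCoeff (suc s) (suc b) (λ α → coefRHS 0 (suc b) 1 (suc s) (0 ∷ α)) w
    ≡⟨ compCoeff-y∷ (suc s) (suc b) (coefRHS 0 (suc b) 1 (suc s)) w ⟨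
  compCoeff (1 + suc s) (suc b) (coefRHS 0 (suc b) 1 (suc s)) (y ∷ w) ∎
shuffleCount-ys^-xs^ys^ (suc b) (suc r) s (y ∷ w) = begin
  shuffleCount (ys^ (suc r)) (xs^ (suc b) ++ ys^ (suc s)) w + 0
    ≡⟨ +-identityʳ _ ⟩
  shuffleCount (ys^ (suc r)) (xs^ (suc b) ++ ys^ (suc s)) w
    ≡⟨ shuffleCount-ys^-xs^ys^ (suc b) r s w ⟩
  compCoeff (suc r + suc s) (suc b) (coefRHS 0 (suc b) (suc r) (suc s)) w
    ≡⟨ compCoeff-cong (suc r + suc s) (suc b) w peel-zero ⟨
  compCoeff (suc r + suc s) (suc b) (λ α → coefRHS 0 (suc b) (suc (suc r)) (suc s) (0 ∷ α)) w
    ≡⟨ compCoeff-y∷ (suc r + suc s) (suc b) (coefRHS 0 (suc b) (suc (suc r)) (suc s)) w ⟨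
  compCoeff (suc (suc r) + suc s) (suc b) (coefRHS 0 (suc b) (suc (suc r)) (suc s)) (y ∷ w) ∎
  where
  peel-zero : ∀ α → length α ≡ suc r + suc s → sum α ≡ suc b →
              coefRHS 0 (suc b) (suc (suc r)) (suc s) (0 ∷ α) ≡ coefRHS 0 (suc b) (suc r) (suc s) α
  peel-zero (h ∷ t) _ sum≡ = coefRHS-0-0∷ b r s h t sum≡

shuffleCount-xs^ys^ : ∀ a b r s w → shuffleCount (xs^ a ++ ys^ (suc r)) (xs^ b ++ ys^ (suc s)) w
                                   ≡ compCoeff (suc r + suc s) (a + b) (coefRHS a b (suc r) (suc s)) w
shuffleCount-xs^ys^ zero b r s w = shuffleCount-ys^-xs^ys^ b r s w
shuffleCount-xs^ys^ (suc a) zero r s w = begin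
  shuffleCount (xs^ (suc a) ++ ys^ (suc r)) (ys^ (suc s)) w
    ≡⟨ shuffleCount-comm (xs^ (suc a) ++ ys^ (suc r)) (ys^ (suc s)) w ⟩
  shuffleCount (ys^ (suc s)) (xs^ (suc a) ++ ys^ (suc r)) w
    ≡⟨ shuffleCount-ys^-xs^ys^ (suc a) s r w ⟩
  compCoeff (suc s + suc r) (suc a) (coefRHS 0 (suc a) (suc s) (suc r)) w
    ≡⟨ compCoeff-cong (suc s + suc r) (suc a) w (λ α _ _ → coefRHS-swap 0 (suc a) (suc s) (suc r) α) ⟩
  compCoeff (suc s + suc r) (suc a) (coefRHS (suc a) 0 (suc r) (suc s)) w
    ≡⟨ cong₂ (λ k n → compCoeff k n (coefRHS (suc a) 0 (suc r) (suc s)) w)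
             (+-comm (suc s) (suc r)) (sym (+-identityʳ (suc a))) ⟩
  compCoeff (suc r + suc s) (suc a + 0) (coefRHS (suc a) 0 (suc r) (suc s)) w ∎
shuffleCount-xs^ys^ (suc a) (suc b) r s [] = sym (compCoeff-[] (r + suc s) (suc a + suc b) _)
shuffleCount-xs^ys^ (suc a) (suc b) r s (x ∷ w) = begin
  shuffleCount (xs^ a ++ ys^ (suc r)) (xs^ (suc b) ++ ys^ (suc s)) w
    + shuffleCount (xs^ (suc a) ++ ys^ (suc r)) (xs^ b ++ ys^ (suc s)) w
    ≡⟨ cong₂ _+_ (shuffleCount-xs^ys^ a (suc b) r s w) (shuffleCount-xs^ys^ (suc a) b r s w) ⟩
  compCoeff K (a + suc b) (coefRHS a (suc b) (suc r) (suc s)) w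
    + compCoeff K (suc a + b) (coefRHS (suc a) b (suc r) (suc s)) w
    ≡⟨ cong (λ n → compCoeff K (a + suc b) (coefRHS a (suc b) (suc r) (suc s)) w
                   + compCoeff K n (coefRHS (suc a) b (suc r) (suc s)) w) (+-suc a b) ⟨
  compCoeff K (a + suc b) (coefRHS a (suc b) (suc r) (suc s)) w
    + compCoeff K (a + suc b) (coefRHS (suc a) b (suc r) (suc s)) w
    ≡⟨ compCoeff-+ K (a + suc b) (coefRHS a (suc b) (suc r) (suc s)) (coefRHS (suc a) b (suc r) (suc s)) w ⟨
  compCoeff K (a + suc b) (λ α → coefRHS a (suc b) (suc r) (suc s) α + coefRHS (suc a) b (suc r) (suc s) α) w
    ≡⟨ compCoeff-cong K (a + suc b) w pascal ⟨
  compCoeff K (a + suc b) (λ α → coefRHS (suc a) (suc b) (suc r) (suc s) (sucHead α)) w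
    ≡⟨ compCoeff-x∷ (r + suc s) (a + suc b) (coefRHS (suc a) (suc b) (suc r) (suc s)) w ⟨
  compCoeff K (suc a + suc b) (coefRHS (suc a) (suc b) (suc r) (suc s)) (x ∷ w) ∎
  where
  K = suc r + suc s
  pascal : ∀ α → length α ≡ K → sum α ≡ a + suc b →
           coefRHS (suc a) (suc b) (suc r) (suc s) (sucHead α)
           ≡ coefRHS a (suc b) (suc r) (suc s) α + coefRHS (suc a) b (suc r) (suc s) α
  pascal (h ∷ t) _ _ = coefRHS-pascal a b (suc r) (suc s) h t
shuffleCount-xs^ys^ (suc a) (suc b) r s (y ∷ w) = sym (trans
  (compCoeff-y∷ (r + suc s) (suc a + suc b) (coefRHS (suc a) (suc b) (suc r) (suc s)) w)
  (compCoeff-zero (r + suc s) (suc a + suc b) w (λ α _ _ → coefRHS-suc-suc-0∷ a b (suc r) (suc s) α)))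

proposition3p1 : (a b r s : ℕ) → 1 ≤ r → 1 ≤ s →
    ⟦ xs^ a ++ ys^ r ⟧ ⧢ ⟦ xs^ b ++ ys^ s ⟧ ≈ rhs a b r s
proposition3p1 a b (suc r) (suc s) _ _ w = begin
  coeff w (⟦ u ⟧ ⧢ ⟦ v ⟧)
    ≡⟨ coeff-⟦⟧⧢⟦⟧ u v w ⟩
  ι (shuffleCount u v w)
    ≡⟨ cong ι (shuffleCount-xs^ys^ a b r s w) ⟩
  ι (compCoeff (suc r + suc s) (a + b) (coefRHS a b (suc r) (suc s)) w)
    ≡⟨ coeff-weighted w (coefRHS a b (suc r) (suc s)) (compositions (suc r + suc s) (a + b)) ⟨
  coeff w (rhs a b (suc r) (suc s)) ∎
  where
  u = xs^ a ++ ys^ (suc r)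
  v = xs^ b ++ ys^ (suc s)
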